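{- Let $(G,w)$ be a vertex-weighted graph, let $e$ be an edge of $G$, and let $\gamma$ be an orientation of $G$. Then $$X_{(G,w,\gamma)}+X_{(G,w,\gamma_{\overleftarrow{e}})}=(1+q)\left(X_{(G\setminus e,w,\gamma)}-X_{(G/e,w/e,\gamma/e)}\right).$$
   Context: A graph $G$ is finite with vertex set $V(G)$ and edge multiset $E(G)$ of pairs of not necessarily distinct vertices (loops and multi-edges allowed). A vertex-weighted graph $(G,w)$ has $w:V(G)\to\mathbb{Z}^+$. A coloring $\kappa:V(G)\to\mathbb{Z}^+$ is proper if $\kappa(v_1)\ne\kappa(v_2)$ whenever some edge has endpoints $v_1,v_2$. An orientation $\gamma$ orders the endpoints of each edge (tail $\to$ head). For a proper coloring $\kappa$, $asc(\kappa)$ is the number of edges oriented $v_1\to v_2$ by $\gamma$ with $\kappa(v_1)<\kappa(v_2)$. Define $X_{(G,w,\gamma)}(q,x_1,x_2,\dots)=\sum_{\kappa}q^{asc(\kappa)}\prod_{v\in V(G)}x_{\kappa(v)}^{w(v)}$ over proper colorings $\kappa$. $\gamma_{\overleftarrow{e}}$ is $\gamma$ with the orientation of $e$ reversed; on $G\setminus e$ (edge $e$ removed) $\gamma$ means its restriction. Contraction: if $e$ is a loop, $G/e=G\setminus e$, $w/e=w$ and $\gamma/e$ is the restriction of $\gamma$; otherwise for $e=v_1v_2$, $G/e$ replaces $v_1,v_2$ by a new vertex $v^*$, removes $e$, and replaces the endpoint $v_1$ and/or $v_2$ of every other edge by $v^*$ (keeping multi-edges and loops); $(w/e)(v^*)=w(v_1)+w(v_2)$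 and $w/e=w$ elsewhere; $\gamma/e$ orients each edge as the corresponding edge of $G$ is oriented by $\gamma$ (with $v_1,v_2$ replaced by $v^*$; an edge between $v_1$ and $v_2$ other than $e$ becomes the loop $v^*\to v^*$). -}

module Defs where

open import Data.Nat using (ℕ; zero; suc; NonZero)
open import Data.Nat.Properties using () renaming (_≟_ to _≟ℕ_)
open import Data.Integer using (ℤ; +_; _+_; _-_; 0ℤ)
open import Data.Fin using (Fin; zero; suc; punchOut)
open import Data.Fin.Properties using (_≟_; _<?_; all?)
open import Data.List using (List; []; _∷_; [_]; map; concatMap; length; filter; allFin; lookup; removeAt; updateAt)
open import Data.Nat.ListAction using (sum)
open import Data.List.Relation.Unary.All using (All)
import Data.List.Relation.Unary.All as All
open import Data.Product using (_×_; _,_; proj₁; proj₂)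
open import Relation.Nullary using (¬_; Dec; yes; no; ¬?; _×-dec_)
open import Relation.Binary.PropositionalEquality using (_≡_; _≢_; refl; sym)
open import Function using (_∘_)

-- The edge multiset is a list of ordered pairs
-- (tail , head): the underlying (unoriented) edge is {tail, head} and the
-- orientation γ is recorded by the order of the pair.  Loops (a , a) and
-- repeated pairs (multi-edges) are allowed.

record OWGraph : Set where
  constructor mkGraph
  field
    n     : ℕ
    w     : Fin n → ℕ                 -- vertex weights (positivity is a hypothesis)
    edges : List (Fin n × Fin n)

open OWGraph public

Edge : OWGraph → Set
Edge G = Fin (length (edges G))

reverseEdge : (G : OWGraph) → Edge G → OWGraph
reverseEdge (mkGraph n w E) e = mkGraph n w (updateAt E e (λ p → proj₂ p , proj₁ p))

deleteEdge : (G : OWGraph) → Edge G → OWGraph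
deleteEdge (mkGraph n w E) e = mkGraph n w (removeAt E e)

merge : ∀ {m} (u v : Fin (suc m)) → u ≢ v → Fin (suc m) → Fin m
merge u v u≢v x with x ≟ v
... | yes _   = punchOut {i = v} {j = u} (λ eq → u≢v (sym eq))
... | no x≢v = punchOut {i = v} {j = x} (λ eq → x≢v (sym eq))

pushWeight : ∀ {n m} → (Fin n → Fin m) → (Fin n → ℕ) → Fin m → ℕ
pushWeight {n} f w y = sum (map w (filter (λ x → f x ≟ y) (allFin n)))

contractEdge : (G : OWGraph) → Edge G → OWGraph
contractEdge (mkGraph n w E) e with lookup E e
contractEdge (mkGraph zero w E) e | () , _
contractEdge (mkGraph (suc m) w E) e | u , v with u ≟ v
... | yes _   = mkGraph (suc m) w (removeAt E e)
... | no u≢v = mkGraph m (pushWeight f w)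
                  (map (λ p → f (proj₁ p) , f (proj₂ p)) (removeAt E e))
  where f = merge u v u≢v

-- Formal power series in q, x₁, x₂, … represented by their coefficients:
-- S N a m  is the coefficient of  q^a x₁^(m 0) ⋯ x_N^(m (N-1)).
-- (Every monomial has this form for some N.)

Series : Set
Series = (N : ℕ) → ℕ → (Fin N → ℕ) → ℤ

_≈ˢ_ : Series → Series → Set
S ≈ˢ T = ∀ N a m → S N a m ≡ T N a m

_+ˢ_ : Series → Series → Series
(S +ˢ T) N a m = S N a m + T N a m

_-ˢ_ : Series → Series → Series
(S -ˢ T) N a m = S N a m - T N a m

onePlusQ* : Series → Series
onePlusQ* S N zero    m = S N zero m
onePlusQ* S N (suc a) m = S N (suc a) m + S N a m

colorings : (n N : ℕ) → List (Fin n → Fin N)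
colorings zero    N = [ (λ ()) ]
colorings (suc n) N =
  concatMap (λ c → map (λ κ → λ { zero → c ; (suc i) → κ i }) (colorings n N)) (allFin N)

module _ {n N : ℕ} (κ : Fin n → Fin N) where

  Proper : List (Fin n × Fin n) → Set
  Proper E = All (λ p → κ (proj₁ p) ≢ κ (proj₂ p)) E

  proper? : (E : List (Fin n × Fin n)) → Dec (Proper E)
  proper? E = All.all? (λ p → ¬? (κ (proj₁ p) ≟ κ (proj₂ p))) E

  asc : List (Fin n × Fin n) → ℕ
  asc E = length (filter (λ p → κ (proj₁ p) <? κ (proj₂ p)) E)

  -- exponent of x_(i+1) in ∏_v x_κ(v)^w(v)
  colorWeight : (Fin n → ℕ) → Fin N → ℕ
  colorWeight w = pushWeight κ w

-- A proper coloring with some colour > N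
-- contributes only monomials involving some x_j with j > N (weights are
-- positive), so colourings into Fin N suffice for monomials in x₁..x_N.
X : OWGraph → Series
X (mkGraph n w E) N a m =
  + length (filter (λ κ → proper? κ E ×-dec ((asc κ E ≟ℕ a) ×-dec all? (λ i → colorWeight κ w i ≟ℕ m i)))
                   (colorings n N))

-- Compare coefficients of q^a x^m: each X counts the colorings with weight monomial
-- x^m and a ascents.  Let e = uv and let E′ be the other edges.  A coloring proper on
-- E′ with κ u ≠ κ v is proper for both orientations of e, and exactly one of them makes
-- e an ascent, so the two graphs together weight it by q^(s+1) + q^s = (1+q) q^s, where
-- s is its number of ascents on E′.  The colorings proper on E′ with κ u = κ v are, via
-- the merge map, exactly the proper colorings of G/e; they contribute q^s to X_(G∖e)
-- and nothing to the left-hand side.  A loop admits no proper coloring, so then both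
-- sides vanish.

module Submission where

open import Level using (Level)
open import Data.Bool using (true; false; if_then_else_)
open import Data.Empty using (⊥-elim)
open import Data.Nat using (ℕ; zero; suc; _+_; _*_; NonZero)
import Data.Nat.Properties as ℕ
open import Algebra.Properties.CommutativeSemigroup ℕ.+-commutativeSemigroup using (interchange)
open import Data.Nat.ListAction using (sum)
open import Data.Integer as ℤ using (0ℤ) renaming (_+_ to _+ℤ_; _-_ to _-ℤ_)
import Data.Integer.Properties as ℤ
open import Data.Integer.Tactic.RingSolver using (solve-∀)
open import Data.Fin using (Fin; zero; suc; punchIn; _<_)
open import Data.Fin.Properties
  using (_≟_; _<?_; <-cmp; all?; punchOut-cong; punchOut-punchIn; punchIn-punchOut; punchInᵢ≢i)
open import Data.List using (List; []; _∷_; _++_; map; filter; length; allFin; lookup; removeAt; updateAt)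
open import Data.List.Properties using (map-cong; filter-≐; filter-none)
open import Data.List.Membership.Propositional using (_∈_)
open import Data.List.Membership.Propositional.Properties using (∈-allFin; ∈-lookup)
open import Data.List.Relation.Unary.All as All using (All; []; _∷_)
import Data.List.Relation.Unary.All.Properties as All
open import Data.List.Relation.Unary.Any as Any using (here; there)
import Data.List.Relation.Unary.Any.Properties as Any
import Data.List.Relation.Unary.AllPairs as AllPairs
import Data.List.Relation.Unary.AllPairs.Properties as AllPairs
open import Data.List.Relation.Unary.Unique.Propositional using (Unique; _∷_)
open import Data.List.Relation.Unary.Unique.Propositional.Properties using (allFin⁺)
import Data.List.Relation.Unary.Unique.Setoid as UniqueS
import Data.List.Relation.Unary.Unique.Setoid.Properties as UniqueSP
import Data.List.Membership.Setoid as MembershipS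
import Data.List.Membership.Setoid.Properties as MembershipSP
open import Data.List.Relation.Binary.Permutation.Propositional
  using (_↭_; ↭-refl; ↭-prep; ↭-swap; ↭-trans; ↭-sym)
open import Data.List.Relation.Binary.Permutation.Propositional.Properties
  using (↭-length; filter-↭; All-resp-↭; ∈-resp-↭)
import Data.List.Relation.Binary.Permutation.Setoid as PermS
import Data.List.Relation.Binary.Permutation.Setoid.Properties as PermSP
open import Data.Product using (_×_; _,_; proj₁; proj₂)
open import Data.Sum using (_⊎_; inj₁; inj₂)
open import Function using (_∘_)
open import Relation.Binary.Bundles using (Setoid)
open import Relation.Binary.Definitions using (_Respects_; tri<; tri≈; tri>)
open import Relation.Binary.PropositionalEquality
open import Relation.Nullary using (¬_; Dec; yes; no; does; ¬?; _×-dec_; contradiction)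
open import Relation.Unary using (Pred; Decidable; _≐_)
open import Relation.Unary.Properties using (_∩?_)
open import Defs

private
  variable
    a b : Level
    A : Set a
    B : Set b

-- Counting and finite sums

𝟙[_] : ∀ {p} {P : Set p} → Dec P → ℕ
𝟙[ P? ] = if does P? then 1 else 0

𝟙-no : ∀ {p} {P : Set p} (P? : Dec P) → ¬ P → 𝟙[ P? ] ≡ 0
𝟙-no P? ¬p with P?
... | yes p = contradiction p ¬p
... | no _  = refl

𝟙-yes : ∀ {p} {P : Set p} (P? : Dec P) → P → 𝟙[ P? ] ≡ 1
𝟙-yes P? p with P?
... | yes _  = refl
... | no ¬p = contradiction p ¬p

count : ∀ {p} {P : Pred A p} → Decidable P → List A → ℕ
count P? xs = length (filter P? xs)

∑ : List A → (A → ℕ) → ℕ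
∑ xs f = sum (map f xs)

syntax ∑ xs (λ x → e) = ∑[ x ∈ xs ] e

module _ {p} {P : Pred A p} (P? : Decidable P) where

  count-∷ : ∀ x xs → count P? (x ∷ xs) ≡ 𝟙[ P? x ] + count P? xs
  count-∷ x xs with does (P? x)
  ... | true  = refl
  ... | false = refl

  count≡∑ : ∀ xs → count P? xs ≡ ∑[ x ∈ xs ] 𝟙[ P? x ]
  count≡∑ []       = refl
  count≡∑ (x ∷ xs) = trans (count-∷ x xs) (cong (𝟙[ P? x ] +_) (count≡∑ xs))

  ∑-filter : ∀ (f : A → ℕ) xs → ∑ (filter P? xs) f ≡ ∑[ x ∈ xs ] (𝟙[ P? x ] * f x)
  ∑-filter f []       = refl
  ∑-filter f (x ∷ xs) with does (P? x)
  ... | true  = cong₂ _+_ (sym (ℕ.*-identityˡ (f x))) (∑-filter f xs)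
  ... | false = ∑-filter f xs

count-cong : ∀ {p q} {P : Pred A p} {Q : Pred A q} (P? : Decidable P) (Q? : Decidable Q) →
             P ≐ Q → ∀ xs → count P? xs ≡ count Q? xs
count-cong P? Q? P≐Q xs = cong length (filter-≐ P? Q? P≐Q xs)

module _ {p q} {P : Pred A p} {Q : Pred A q} (P? : Decidable P) (Q? : Decidable Q) where

  count-filter : ∀ xs → count P? (filter Q? xs) ≡ count (Q? ∩? P?) xs
  count-filter []       = refl
  count-filter (x ∷ xs) with Q? x
  ... | no _ = count-filter xs
  ... | yes _ with P? x
  ...   | yes _ = cong suc (count-filter xs)
  ...   | no _  = count-filter xs

count-map : ∀ {p} {P : Pred B p} (P? : Decidable P) (f : A → B) xs →
            count P? (map f xs) ≡ count (P? ∘ f) xs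
count-map P? f []       = refl
count-map P? f (x ∷ xs) = begin
  count P? (map f (x ∷ xs))          ≡⟨ count-∷ P? (f x) (map f xs) ⟩
  𝟙[ P? (f x) ] + count P? (map f xs) ≡⟨ cong (𝟙[ P? (f x) ] +_) (count-map P? f xs) ⟩
  𝟙[ P? (f x) ] + count (P? ∘ f) xs   ≡⟨ count-∷ (P? ∘ f) x xs ⟨
  count (P? ∘ f) (x ∷ xs)            ∎
  where open ≡-Reasoning

∑-cong : ∀ {f g : A → ℕ} → (∀ x → f x ≡ g x) → ∀ xs → ∑ xs f ≡ ∑ xs g
∑-cong f≗g xs = cong sum (map-cong f≗g xs)

∑-+ : ∀ (f g : A → ℕ) xs → ∑[ x ∈ xs ] (f x + g x) ≡ ∑ xs f + ∑ xs g
∑-+ f g []       = refl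
∑-+ f g (x ∷ xs) = trans (cong (f x + g x +_) (∑-+ f g xs)) (interchange (f x) (g x) (∑ xs f) (∑ xs g))

∑-*ˡ : ∀ c (f : A → ℕ) xs → c * ∑ xs f ≡ ∑[ x ∈ xs ] (c * f x)
∑-*ˡ c f []       = ℕ.*-zeroʳ c
∑-*ˡ c f (x ∷ xs) = trans (ℕ.*-distribˡ-+ c (f x) _) (cong (c * f x +_) (∑-*ˡ c f xs))

∑-vanishing : ∀ {f : A → ℕ} {xs} → All (λ x → f x ≡ 0) xs → ∑ xs f ≡ 0
∑-vanishing []         = refl
∑-vanishing (fx≡0 ∷ p) = cong₂ _+_ fx≡0 (∑-vanishing p)

∑-swap : ∀ (f : A → B → ℕ) xs ys →
         ∑[ x ∈ xs ] ∑[ y ∈ ys ] f x y ≡ ∑[ y ∈ ys ] ∑[ x ∈ xs ] f x y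
∑-swap f []       ys = sym (∑-vanishing {xs = ys} (All.tabulate (λ _ → refl)))
∑-swap f (x ∷ xs) ys = trans (cong (∑[ y ∈ ys ] f x y +_) (∑-swap f xs ys))
                             (sym (∑-+ (f x) (λ y → ∑[ x′ ∈ xs ] f x′ y) ys))

∑-point : ∀ {f : A → ℕ} {xs y} → Unique xs → y ∈ xs → (∀ x → x ≢ y → f x ≡ 0) → ∑ xs f ≡ f y
∑-point {f = f} {y = y} (y∉xs ∷ _) (here refl) off =
  trans (cong (f y +_) (∑-vanishing (All.map (λ y≢x → off _ (y≢x ∘ sym)) y∉xs)))
        (ℕ.+-identityʳ (f y))
∑-point (x∉xs ∷ !xs) (there y∈xs) off =
  cong₂ _+_ (off _ (All.lookup x∉xs y∈xs)) (∑-point !xs y∈xs off)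

-- Permutations

updateAt-↭ : ∀ (xs : List A) i (g : A → A) →
             updateAt xs i g ↭ g (lookup xs i) ∷ removeAt xs i
updateAt-↭ (x ∷ xs) zero    g = ↭-refl
updateAt-↭ (x ∷ xs) (suc i) g = ↭-trans (↭-prep x (updateAt-↭ xs i g)) (↭-swap x _ ↭-refl)

lookup-↭ : ∀ (xs : List A) i → xs ↭ lookup xs i ∷ removeAt xs i
lookup-↭ (x ∷ xs) zero    = ↭-refl
lookup-↭ (x ∷ xs) (suc i) = ↭-trans (↭-prep x (lookup-↭ xs i)) (↭-swap x _ ↭-refl)

count-↭ : ∀ {p} {P : Pred A p} (P? : Decidable P) {xs ys} → xs ↭ ys → count P? xs ≡ count P? ys
count-↭ P? xs↭ys = ↭-length (filter-↭ P? xs↭ys)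

module _ {ℓ : Level} (S : Setoid a ℓ) where
  open Setoid S using (Carrier; _≈_) renaming (refl to ≈-refl; sym to ≈-sym; trans to ≈-trans)
  open PermS S using (prep)
    renaming (_↭_ to _↭ₛ_; refl to ≋⇒↭; ↭-refl to ↭ₛ-refl; ↭-sym to ↭ₛ-sym; ↭-trans to ↭ₛ-trans)
  open PermSP S using (↭-shift; Unique-resp-↭) renaming (∈-resp-↭ to ∈ₛ-resp-↭)
  open MembershipS S using () renaming (_∈_ to _∈ₛ_)
  open MembershipSP using (∈-∃++; ∈-resp-≈)
  open UniqueS S using () renaming (Unique to Uniqueₛ)
  open UniqueSP using (Unique[x∷xs]⇒x∉xs)

  unique-↭ : ∀ {xs ys} → Uniqueₛ xs → Uniqueₛ ys →
             (∀ {z} → z ∈ₛ xs → z ∈ₛ ys) → (∀ {z} → z ∈ₛ ys → z ∈ₛ xs) → xs ↭ₛ ys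
  unique-↭ {[]}     {[]}     _ _ _ _ = ↭ₛ-refl
  unique-↭ {[]}     {y ∷ ys} _ _ _ ys⊆ with ys⊆ (here ≈-refl)
  ... | ()
  unique-↭ {x ∷ xs} {ys} !x∷xs !ys xs⊆ ys⊆ with ∈-∃++ S (xs⊆ (here ≈-refl))
  ... | as , bs , y , x≈y , ys≋ =
    ↭ₛ-trans (prep x≈y (unique-↭ (AllPairs.tail !x∷xs) (AllPairs.tail !y∷rest) xs⊆rest rest⊆xs))
             (↭ₛ-sym ys↭)
    where
    ys↭ : ys ↭ₛ y ∷ as ++ bs
    ys↭ = ↭ₛ-trans (≋⇒↭ ys≋) (↭-shift as bs)
    !y∷rest : Uniqueₛ (y ∷ as ++ bs)
    !y∷rest = Unique-resp-↭ ys↭ !ys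
    xs⊆rest : ∀ {z} → z ∈ₛ xs → z ∈ₛ as ++ bs
    xs⊆rest {z} z∈xs with ∈ₛ-resp-↭ ys↭ (xs⊆ (there z∈xs))
    ... | here z≈y     = contradiction (∈-resp-≈ S (≈-trans z≈y (≈-sym x≈y)) z∈xs)
                                       (Unique[x∷xs]⇒x∉xs S !x∷xs)
    ... | there z∈rest = z∈rest
    rest⊆xs : ∀ {z} → z ∈ₛ as ++ bs → z ∈ₛ xs
    rest⊆xs {z} z∈rest with ys⊆ (∈ₛ-resp-↭ (↭ₛ-sym ys↭) (there z∈rest))
    ... | here z≈x   = contradiction (∈-resp-≈ S (≈-trans z≈x x≈y) z∈rest)
                                     (Unique[x∷xs]⇒x∉xs S !y∷rest)
    ... | there z∈xs = z∈xs

  count-resp-↭ : ∀ {p} {P : Pred Carrier p} (P? : Decidable P) → P Respects _≈_ →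
                 ∀ {xs ys} → xs ↭ₛ ys → count P? xs ≡ count P? ys
  count-resp-↭ P? resp xs↭ys = PermSP.xs↭ys⇒|xs|≡|ys| S (PermSP.filter⁺ S P? resp xs↭ys)

-- Colorings, weights and the merge map

Colorings : ℕ → ℕ → Setoid _ _
Colorings n N = Fin n →-setoid Fin N

colorings-complete : ∀ n N (κ : Fin n → Fin N) → MembershipS._∈_ (Colorings n N) κ (colorings n N)
colorings-complete zero    N κ = here (λ ())
colorings-complete (suc n) N κ =
  Any.concat⁺ (Any.map⁺ (Any.map (λ { refl → Any.map⁺ (Any.map (λ eq → λ { zero → refl ; (suc i) → eq i })
                                                              (colorings-complete n N (κ ∘ suc))) })
                                 (∈-allFin (κ zero))))

colorings-unique : ∀ n N → UniqueS.Unique (Colorings n N) (colorings n N)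
colorings-unique zero    N = [] AllPairs.∷ AllPairs.[]
colorings-unique (suc n) N =
  UniqueSP.concat⁺ (Colorings (suc n) N)
    (All.map⁺ (All.tabulate (λ _ → UniqueSP.map⁺ (Colorings n N) (Colorings (suc n) N) (λ eq i → eq (suc i))
                                                  (colorings-unique n N))))
    (AllPairs.map⁺ (AllPairs.map
      (λ c≢c′ {_} (κ∈ , κ∈′) → c≢c′ (trans (sym (proj₂ (Any.satisfied (Any.map⁻ κ∈)) zero))
                                           (proj₂ (Any.satisfied (Any.map⁻ κ∈′)) zero)))
      (allFin⁺ N)))

pushWeight-cong : ∀ {n m} {f g : Fin n → Fin m} → f ≗ g →
                  ∀ (w : Fin n → ℕ) y → pushWeight f w y ≡ pushWeight g w y
pushWeight-cong {n} {f = f} {g} f≗g w y =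
  cong (λ xs → ∑ xs w) (filter-≐ (λ x → f x ≟ y) (λ x → g x ≟ y)
                                 ((λ {x} → trans (sym (f≗g x))) , (λ {x} → trans (f≗g x))) (allFin n))

pushWeight-∘ : ∀ {n m k} (f : Fin n → Fin m) (g : Fin m → Fin k) (w : Fin n → ℕ) i →
               pushWeight g (pushWeight f w) i ≡ pushWeight (g ∘ f) w i
pushWeight-∘ {n} {m} f g w i = begin
  pushWeight g (pushWeight f w) i
    ≡⟨ ∑-filter (λ y → g y ≟ i) (pushWeight f w) (allFin m) ⟩
  ∑[ y ∈ allFin m ] (𝟙[ g y ≟ i ] * pushWeight f w y)
    ≡⟨ ∑-cong (λ y → cong (𝟙[ g y ≟ i ] *_) (∑-filter (λ x → f x ≟ y) w (allFin n))) (allFin m) ⟩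
  ∑[ y ∈ allFin m ] (𝟙[ g y ≟ i ] * ∑[ x ∈ allFin n ] (𝟙[ f x ≟ y ] * w x))
    ≡⟨ ∑-cong (λ y → ∑-*ˡ 𝟙[ g y ≟ i ] (λ x → 𝟙[ f x ≟ y ] * w x) (allFin n)) (allFin m) ⟩
  ∑[ y ∈ allFin m ] ∑[ x ∈ allFin n ] term x y
    ≡⟨ ∑-swap (λ y x → term x y) (allFin m) (allFin n) ⟩
  ∑[ x ∈ allFin n ] ∑[ y ∈ allFin m ] term x y
    ≡⟨ ∑-cong (λ x → ∑-point (allFin⁺ m) (∈-allFin (f x)) (off-diagonal x)) (allFin n) ⟩
  ∑[ x ∈ allFin n ] term x (f x)
    ≡⟨ ∑-cong (λ x → cong (λ t → 𝟙[ g (f x) ≟ i ] * t) (diagonal x)) (allFin n) ⟩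
  ∑[ x ∈ allFin n ] (𝟙[ g (f x) ≟ i ] * w x)
    ≡⟨ sym (∑-filter (λ x → g (f x) ≟ i) w (allFin n)) ⟩
  pushWeight (g ∘ f) w i ∎
  where
  open ≡-Reasoning
  term : Fin n → Fin m → ℕ
  term x y = 𝟙[ g y ≟ i ] * (𝟙[ f x ≟ y ] * w x)
  off-diagonal : ∀ x y → y ≢ f x → term x y ≡ 0
  off-diagonal x y y≢fx =
    trans (cong (λ t → 𝟙[ g y ≟ i ] * (t * w x)) (𝟙-no (f x ≟ y) (y≢fx ∘ sym))) (ℕ.*-zeroʳ 𝟙[ g y ≟ i ])
  diagonal : ∀ x → 𝟙[ f x ≟ f x ] * w x ≡ w x
  diagonal x = trans (cong (_* w x) (𝟙-yes (f x ≟ f x) refl)) (ℕ.*-identityˡ (w x))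

module _ {m : ℕ} (u v : Fin (suc m)) (u≢v : u ≢ v) where

  merge-identifies : merge u v u≢v u ≡ merge u v u≢v v
  merge-identifies with u ≟ v | v ≟ v
  ... | yes u≡v | _      = ⊥-elim (u≢v u≡v)
  ... | no _    | yes _  = punchOut-cong v refl
  ... | no _    | no v≢v = ⊥-elim (v≢v refl)

  merge-punchIn : ∀ y → merge u v u≢v (punchIn v y) ≡ y
  merge-punchIn y with punchIn v y ≟ v
  ... | yes eq = ⊥-elim (punchInᵢ≢i v y eq)
  ... | no _   = trans (punchOut-cong v refl) (punchOut-punchIn v)

  merge-factors : ∀ {N} (κ : Fin (suc m) → Fin N) → κ u ≡ κ v → κ ≗ κ ∘ punchIn v ∘ merge u v u≢v
  merge-factors κ κu≡κv x with x ≟ v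
  ... | yes refl = trans (sym κu≡κv) (cong κ (sym (punchIn-punchOut _)))
  ... | no _     = cong κ (sym (punchIn-punchOut _))

-- The contribution of a single coloring

onePlusQᴺ : (ℕ → ℕ) → ℕ → ℕ
onePlusQᴺ f zero    = f zero
onePlusQᴺ f (suc a) = f (suc a) + f a

onePlusQᴺ-cong : ∀ {f g : ℕ → ℕ} → (∀ b → f b ≡ g b) → ∀ a → onePlusQᴺ f a ≡ onePlusQᴺ g a
onePlusQᴺ-cong f≗g zero    = f≗g zero
onePlusQᴺ-cong f≗g (suc a) = cong₂ _+_ (f≗g (suc a)) (f≗g a)

∑-onePlusQᴺ : ∀ (f : A → ℕ → ℕ) xs b →
              ∑[ x ∈ xs ] onePlusQᴺ (f x) b ≡ onePlusQᴺ (λ c → ∑[ x ∈ xs ] f x c) b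
∑-onePlusQᴺ f xs zero    = refl
∑-onePlusQᴺ f xs (suc b) = ∑-+ (λ x → f x (suc b)) (λ x → f x b) xs

module _ {N : ℕ} where

  oriented? : (c₁ c₂ : Fin N) (ascent s a : ℕ) → Dec (c₁ ≢ c₂ × ascent + s ≡ a)
  oriented? c₁ c₂ ascent s a = ¬? (c₁ ≟ c₂) ×-dec (ascent + s ℕ.≟ a)

  monochromatic? : (c₁ c₂ : Fin N) (s a : ℕ) → Dec (c₁ ≡ c₂ × s ≡ a)
  monochromatic? c₁ c₂ s a = (c₁ ≟ c₂) ×-dec (s ℕ.≟ a)

  OneAscent : ℕ → ℕ → Set
  OneAscent i₁ i₂ = (i₁ ≡ 1 × i₂ ≡ 0) ⊎ (i₁ ≡ 0 × i₂ ≡ 1)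

  one-ascent : ∀ {c₁ c₂ : Fin N} → c₁ ≢ c₂ → OneAscent 𝟙[ c₁ <? c₂ ] 𝟙[ c₂ <? c₁ ]
  one-ascent {c₁} {c₂} c₁≢c₂ with <-cmp c₁ c₂
  ... | tri< c₁<c₂ _ c₂≮c₁ = inj₁ (𝟙-yes (c₁ <? c₂) c₁<c₂ , 𝟙-no (c₂ <? c₁) c₂≮c₁)
  ... | tri≈ _ c₁≡c₂ _     = contradiction c₁≡c₂ c₁≢c₂
  ... | tri> c₁≮c₂ _ c₂<c₁ = inj₂ (𝟙-no (c₁ <? c₂) c₁≮c₂ , 𝟙-yes (c₂ <? c₁) c₂<c₁)

  -- The ascent indicators are variables rather than 𝟙[ c₁ <? c₂ ]: Fin's _<?_ unfolds to a
  -- Boolean test on toℕ, over which `with` cannot abstract.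
  edge-split : ∀ c₁ c₂ i₁ i₂ s a → (c₁ ≢ c₂ → OneAscent i₁ i₂) →
               𝟙[ oriented? c₁ c₂ i₁ s a ] + 𝟙[ oriented? c₂ c₁ i₂ s a ]
                 + onePlusQᴺ (𝟙[_] ∘ monochromatic? c₁ c₂ s) a
               ≡ onePlusQᴺ (𝟙[_] ∘ (s ℕ.≟_)) a
  edge-split c₁ c₂ i₁ i₂ s a ascents with c₁ ≟ c₂ | c₂ ≟ c₁
  ... | yes refl | yes _    = refl
  ... | yes refl | no c₁≢c₁ = contradiction refl c₁≢c₁
  ... | no c₁≢c₂ | yes refl = contradiction refl c₁≢c₂
  ... | no c₁≢c₂ | no _ with ascents c₁≢c₂
  ...   | inj₁ (refl , refl) = ascent-first a
    where
    ascent-first : ∀ a → 𝟙[ suc s ℕ.≟ a ] + 𝟙[ s ℕ.≟ a ] + onePlusQᴺ (λ _ → 0) a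
                         ≡ onePlusQᴺ (𝟙[_] ∘ (s ℕ.≟_)) a
    ascent-first zero    = ℕ.+-identityʳ _
    ascent-first (suc a) = trans (ℕ.+-identityʳ _) (ℕ.+-comm 𝟙[ s ℕ.≟ a ] _)
  ...   | inj₂ (refl , refl) = ascent-second a
    where
    ascent-second : ∀ a → 𝟙[ s ℕ.≟ a ] + 𝟙[ suc s ℕ.≟ a ] + onePlusQᴺ (λ _ → 0) a
                          ≡ onePlusQᴺ (𝟙[_] ∘ (s ℕ.≟_)) a
    ascent-second zero    = trans (ℕ.+-identityʳ _) (ℕ.+-identityʳ _)
    ascent-second (suc a) = ℕ.+-identityʳ _

module _ {p} {P₁ P₂ : Pred A p} {M D : ℕ → Pred A p} (P₁? : Decidable P₁) (P₂? : Decidable P₂)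
         (M? : ∀ b → Decidable (M b)) (D? : ∀ b → Decidable (D b)) where

  count-identity : ∀ xs c →
    (∀ x → 𝟙[ P₁? x ] + 𝟙[ P₂? x ] + onePlusQᴺ (λ b → 𝟙[ M? b x ]) c ≡ onePlusQᴺ (λ b → 𝟙[ D? b x ]) c) →
    count P₁? xs + count P₂? xs + onePlusQᴺ (λ b → count (M? b) xs) c ≡ onePlusQᴺ (λ b → count (D? b) xs) c
  count-identity xs c pointwise = begin
    count P₁? xs + count P₂? xs + onePlusQᴺ (λ b → count (M? b) xs) c
      ≡⟨ cong₂ _+_ (cong₂ _+_ (count≡∑ P₁? xs) (count≡∑ P₂? xs))
                   (onePlusQᴺ-cong (λ b → count≡∑ (M? b) xs) c) ⟩
    ∑ xs (𝟙[_] ∘ P₁?) + ∑ xs (𝟙[_] ∘ P₂?) + onePlusQᴺ (λ b → ∑ xs (𝟙[_] ∘ M? b)) c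
      ≡⟨ cong (_ +_) (∑-onePlusQᴺ (λ x b → 𝟙[ M? b x ]) xs c) ⟨
    ∑ xs (𝟙[_] ∘ P₁?) + ∑ xs (𝟙[_] ∘ P₂?) + ∑[ x ∈ xs ] onePlusQᴺ (λ b → 𝟙[ M? b x ]) c
      ≡⟨ cong (_+ _) (∑-+ (𝟙[_] ∘ P₁?) (𝟙[_] ∘ P₂?) xs) ⟨
    ∑[ x ∈ xs ] (𝟙[ P₁? x ] + 𝟙[ P₂? x ]) + ∑[ x ∈ xs ] onePlusQᴺ (λ b → 𝟙[ M? b x ]) c
      ≡⟨ ∑-+ (λ x → 𝟙[ P₁? x ] + 𝟙[ P₂? x ]) (λ x → onePlusQᴺ (λ b → 𝟙[ M? b x ]) c) xs ⟨
    ∑[ x ∈ xs ] (𝟙[ P₁? x ] + 𝟙[ P₂? x ] + onePlusQᴺ (λ b → 𝟙[ M? b x ]) c)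
      ≡⟨ ∑-cong pointwise xs ⟩
    ∑[ x ∈ xs ] onePlusQᴺ (λ b → 𝟙[ D? b x ]) c
      ≡⟨ ∑-onePlusQᴺ (λ x b → 𝟙[ D? b x ]) xs c ⟩
    onePlusQᴺ (λ b → ∑ xs (𝟙[_] ∘ D? b)) c
      ≡⟨ onePlusQᴺ-cong (λ b → count≡∑ (D? b) xs) c ⟨
    onePlusQᴺ (λ b → count (D? b) xs) c ∎
    where open ≡-Reasoning

-- Coefficients of X as counts

module _ {n N : ℕ} {κ₁ κ₂ : Fin n → Fin N} (κ₁≗κ₂ : κ₁ ≗ κ₂) where

  Proper-resp : ∀ F → Proper κ₁ F → Proper κ₂ F
  Proper-resp F = All.map (λ κ₁p≢ κ₂p≡ → κ₁p≢ (trans (κ₁≗κ₂ _) (trans κ₂p≡ (sym (κ₁≗κ₂ _)))))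

  asc-cong : ∀ F → asc κ₁ F ≡ asc κ₂ F
  asc-cong F = count-cong _ _ ((λ {p} → subst₂ _<_ (κ₁≗κ₂ (proj₁ p)) (κ₁≗κ₂ (proj₂ p))) ,
                               (λ {p} → subst₂ _<_ (sym (κ₁≗κ₂ (proj₁ p))) (sym (κ₁≗κ₂ (proj₂ p))))) F

module Coefficients {n N : ℕ} (w : Fin n → ℕ) (mt : Fin N → ℕ) where

  HasWeight : (Fin n → Fin N) → Set
  HasWeight κ = ∀ i → colorWeight κ w i ≡ mt i

  hasWeight? : Decidable HasWeight
  hasWeight? κ = all? (λ i → colorWeight κ w i ℕ.≟ mt i)

  Counted : List (Fin n × Fin n) → ℕ → (Fin n → Fin N) → Set
  Counted F a κ = Proper κ F × (asc κ F ≡ a × HasWeight κ)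

  -- Definitionally the predicate filtered by X, so X (mkGraph n w F) N a mt reduces to
  -- + count (counted? F a) (colorings n N).
  counted? : ∀ F a → Decidable (Counted F a)
  counted? F a κ = proper? κ F ×-dec ((asc κ F ℕ.≟ a) ×-dec hasWeight? κ)

  admissible? : ∀ F → Decidable (λ κ → Proper κ F × HasWeight κ)
  admissible? F κ = proper? κ F ×-dec hasWeight? κ

  admissible : List (Fin n × Fin n) → List (Fin n → Fin N)
  admissible F = filter (admissible? F) (colorings n N)

  counted-resp : ∀ F a {κ₁ κ₂} → κ₁ ≗ κ₂ → Counted F a κ₁ → Counted F a κ₂
  counted-resp F a κ₁≗κ₂ (proper , ascents , weight) =
    Proper-resp κ₁≗κ₂ F proper , trans (sym (asc-cong κ₁≗κ₂ F)) ascents ,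
    λ i → trans (sym (pushWeight-cong κ₁≗κ₂ w i)) (weight i)

  deleted-count : ∀ F a →
                  count (counted? F a) (colorings n N) ≡ count (λ κ → asc κ F ℕ.≟ a) (admissible F)
  deleted-count F a =
    trans (count-cong _ _ ((λ (p , s , h) → (p , h) , s) , (λ ((p , h) , s) → p , s , h)) (colorings n N))
          (sym (count-filter _ _ (colorings n N)))

  oriented-count : ∀ {F F′ t h} → F ↭ (t , h) ∷ F′ → ∀ a →
                   count (counted? F a) (colorings n N)
                     ≡ count (λ κ → oriented? (κ t) (κ h) 𝟙[ κ t <? κ h ] (asc κ F′) a) (admissible F′)
  oriented-count {F} {F′} {t} {h} F↭ a =
    trans (count-cong _ _ (split , unsplit) (colorings n N)) (sym (count-filter _ _ (colorings n N)))
    where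
    asc-split : ∀ κ → asc κ F ≡ 𝟙[ κ t <? κ h ] + asc κ F′
    asc-split κ = trans (count-↭ _ F↭) (count-∷ _ (t , h) F′)
    Split : (Fin n → Fin N) → Set
    Split κ = (Proper κ F′ × HasWeight κ) × (κ t ≢ κ h × 𝟙[ κ t <? κ h ] + asc κ F′ ≡ a)
    split : ∀ {κ} → Counted F a κ → Split κ
    split {κ} (proper , ascents , weight) with All-resp-↭ F↭ proper
    ... | κt≢κh ∷ proper′ = (proper′ , weight) , κt≢κh , trans (sym (asc-split κ)) ascents
    unsplit : ∀ {κ} → Split κ → Counted F a κ
    unsplit {κ} ((proper′ , weight) , κt≢κh , ascents) =
      All-resp-↭ (↭-sym F↭) (κt≢κh ∷ proper′) , trans (asc-split κ) ascents , weight

module Contraction {m N : ℕ} (w : Fin (suc m) → ℕ) (mt : Fin N → ℕ)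
                   (F : List (Fin (suc m) × Fin (suc m))) {u v : Fin (suc m)} (u≢v : u ≢ v) where

  open Coefficients w mt
  private
    module Merged = Coefficients (pushWeight (merge u v u≢v) w) mt
    f = merge u v u≢v
    S = Colorings (suc m) N
    open MembershipS S using () renaming (_∈_ to _∈ₛ_)

  contracted-edges : List (Fin m × Fin m)
  contracted-edges = map (λ p → f (proj₁ p) , f (proj₂ p)) F

  contracted : OWGraph
  contracted = mkGraph m (pushWeight f w) contracted-edges

  identifies? : Decidable (λ (κ : Fin (suc m) → Fin N) → κ u ≡ κ v)
  identifies? κ = κ u ≟ κ v

  identifies-resp : ∀ {κ₁ κ₂ : Fin (suc m) → Fin N} → κ₁ ≗ κ₂ → κ₁ u ≡ κ₁ v → κ₂ u ≡ κ₂ v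
  identifies-resp κ₁≗κ₂ κ₁u≡κ₁v = trans (sym (κ₁≗κ₂ u)) (trans κ₁u≡κ₁v (κ₁≗κ₂ v))

  ∘merge-injective : ∀ {κ₁ κ₂ : Fin m → Fin N} → κ₁ ∘ f ≗ κ₂ ∘ f → κ₁ ≗ κ₂
  ∘merge-injective {κ₁} {κ₂} κ₁f≗κ₂f y = begin
    κ₁ y                  ≡⟨ cong κ₁ (merge-punchIn u v u≢v y) ⟨
    κ₁ (f (punchIn v y))  ≡⟨ κ₁f≗κ₂f (punchIn v y) ⟩
    κ₂ (f (punchIn v y))  ≡⟨ cong κ₂ (merge-punchIn u v u≢v y) ⟩
    κ₂ y                  ∎
    where open ≡-Reasoning

  lifts↭identifying : PermS._↭_ S (map (_∘ f) (colorings m N)) (filter identifies? (colorings (suc m) N))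
  lifts↭identifying = unique-↭ S
    (UniqueSP.map⁺ (Colorings m N) S ∘merge-injective (colorings-unique m N))
    (UniqueSP.filter⁺ S identifies? (colorings-unique (suc m) N))
    lift∈ identifying∈
    where
    lift∈ : ∀ {κ} → κ ∈ₛ map (_∘ f) (colorings m N) → κ ∈ₛ filter identifies? (colorings (suc m) N)
    lift∈ {κ} κ∈ with Any.satisfied (Any.map⁻ κ∈)
    ... | κ′ , κ≗κ′f =
      MembershipSP.∈-filter⁺ S identifies? identifies-resp (colorings-complete (suc m) N κ)
        (identifies-resp (sym ∘ κ≗κ′f) (cong κ′ (merge-identifies u v u≢v)))
    identifying∈ : ∀ {κ} → κ ∈ₛ filter identifies? (colorings (suc m) N) → κ ∈ₛ map (_∘ f) (colorings m N)
    identifying∈ {κ} κ∈ with MembershipSP.∈-filter⁻ S identifies? identifies-resp {xs = colorings (suc m) N} κ∈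
    ... | _ , κu≡κv =
      MembershipSP.∈-resp-≈ S (sym ∘ merge-factors u v u≢v κ κu≡κv)
        (MembershipSP.∈-map⁺ (Colorings m N) S (_∘ f) (colorings-complete m N (κ ∘ punchIn v)))

  contracted-count : ∀ a → count (Merged.counted? contracted-edges a) (colorings m N)
                           ≡ count (λ κ → monochromatic? (κ u) (κ v) (asc κ F) a) (admissible F)
  contracted-count a = begin
    count (Merged.counted? contracted-edges a) (colorings m N)
      ≡⟨ count-cong _ _ (pull , push) (colorings m N) ⟩
    count (counted? F a ∘ (_∘ f)) (colorings m N)
      ≡⟨ count-map (counted? F a) (_∘ f) (colorings m N) ⟨
    count (counted? F a) (map (_∘ f) (colorings m N))
      ≡⟨ count-resp-↭ S (counted? F a) (counted-resp F a) lifts↭identifying ⟩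
    count (counted? F a) (filter identifies? (colorings (suc m) N))
      ≡⟨ count-filter _ _ (colorings (suc m) N) ⟩
    count (identifies? ∩? counted? F a) (colorings (suc m) N)
      ≡⟨ count-cong _ _ ((λ (e , p , s , h) → (p , h) , e , s) , (λ ((p , h) , e , s) → e , p , s , h))
                    (colorings (suc m) N) ⟩
    count (admissible? F ∩? (λ κ → monochromatic? (κ u) (κ v) (asc κ F) a)) (colorings (suc m) N)
      ≡⟨ count-filter _ _ (colorings (suc m) N) ⟨
    count (λ κ → monochromatic? (κ u) (κ v) (asc κ F) a) (admissible F) ∎
    where
    open ≡-Reasoning
    pull : ∀ {κ} → Merged.Counted contracted-edges a κ → Counted F a (κ ∘ f)
    pull (proper , ascents , weight) =
      All.map⁻ proper , trans (sym (count-map _ _ F)) ascents ,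
      λ i → trans (sym (pushWeight-∘ f _ w i)) (weight i)
    push : ∀ {κ} → Counted F a (κ ∘ f) → Merged.Counted contracted-edges a κ
    push (proper , ascents , weight) =
      All.map⁺ proper , trans (count-map _ _ F) ascents ,
      λ i → trans (pushWeight-∘ f _ w i) (weight i)

-- Deletion–contraction

onePlusQ*-counts : ∀ (S T : Series) N m {d c : ℕ → ℕ} →
                   (∀ b → S N b m ≡ ℤ.+ d b) → (∀ b → T N b m ≡ ℤ.+ c b) →
                   ∀ a → onePlusQ* (S -ˢ T) N a m ≡ ℤ.+ onePlusQᴺ d a -ℤ ℤ.+ onePlusQᴺ c a
onePlusQ*-counts S T N m S≡d T≡c zero    = cong₂ _-ℤ_ (S≡d 0) (T≡c 0)
onePlusQ*-counts S T N m {d} {c} S≡d T≡c (suc a) = begin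
  (S N (suc a) m -ℤ T N (suc a) m) +ℤ (S N a m -ℤ T N a m)
    ≡⟨ cong₂ _+ℤ_ (cong₂ _-ℤ_ (S≡d (suc a)) (T≡c (suc a))) (cong₂ _-ℤ_ (S≡d a) (T≡c a)) ⟩
  (ℤ.+ d (suc a) -ℤ ℤ.+ c (suc a)) +ℤ (ℤ.+ d a -ℤ ℤ.+ c a)
    ≡⟨ regroup (ℤ.+ d (suc a)) (ℤ.+ c (suc a)) (ℤ.+ d a) (ℤ.+ c a) ⟩
  (ℤ.+ d (suc a) +ℤ ℤ.+ d a) -ℤ (ℤ.+ c (suc a) +ℤ ℤ.+ c a)
    ≡⟨ cong₂ _-ℤ_ (ℤ.pos-+ (d (suc a)) (d a)) (ℤ.pos-+ (c (suc a)) (c a)) ⟨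
  ℤ.+ (d (suc a) + d a) -ℤ ℤ.+ (c (suc a) + c a) ∎
  where
  open ≡-Reasoning
  regroup : ∀ p q r s → (p -ℤ q) +ℤ (r -ℤ s) ≡ (p +ℤ r) -ℤ (q +ℤ s)
  regroup = solve-∀

x+y+c≡d⇒x+y≡d-c : ∀ x y c d → x + y + c ≡ d → ℤ.+ x +ℤ ℤ.+ y ≡ ℤ.+ d -ℤ ℤ.+ c
x+y+c≡d⇒x+y≡d-c x y c d x+y+c≡d = begin
  ℤ.+ x +ℤ ℤ.+ y                     ≡⟨ cancel (ℤ.+ x +ℤ ℤ.+ y) (ℤ.+ c) ⟩
  (ℤ.+ x +ℤ ℤ.+ y +ℤ ℤ.+ c) -ℤ ℤ.+ c  ≡⟨ cong (λ t → (t +ℤ ℤ.+ c) -ℤ ℤ.+ c) (ℤ.pos-+ x y) ⟨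
  (ℤ.+ (x + y) +ℤ ℤ.+ c) -ℤ ℤ.+ c     ≡⟨ cong (_-ℤ ℤ.+ c) (ℤ.pos-+ (x + y) c) ⟨
  ℤ.+ (x + y + c) -ℤ ℤ.+ c            ≡⟨ cong (λ t → ℤ.+ t -ℤ ℤ.+ c) x+y+c≡d ⟩
  ℤ.+ d -ℤ ℤ.+ c                      ∎
  where
  open ≡-Reasoning
  cancel : ∀ p q → p ≡ (p +ℤ q) -ℤ q
  cancel = solve-∀

X-loop≡0 : ∀ {n} (w : Fin n → ℕ) F {t} → (t , t) ∈ F → ∀ N a mt → X (mkGraph n w F) N a mt ≡ 0ℤ
X-loop≡0 {n} w F t∈F N a mt =
  cong (ℤ.+_ ∘ length) (filter-none (counted? F a) {colorings n N}
                                    (All.tabulate (λ _ (proper , _) → All.lookup proper t∈F refl)))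
  where open Coefficients w mt

swap : ∀ {A : Set} → A × A → A × A
swap p = proj₂ p , proj₁ p

module _ {m N : ℕ} (w : Fin (suc m) → ℕ) (mt : Fin N → ℕ)
         (E : List (Fin (suc m) × Fin (suc m))) (e : Fin (length E)) where

  private
    G = mkGraph (suc m) w E
    Gʳ = reverseEdge G e
    E′ = removeAt E e
    open Coefficients w mt

  loop-identity : ∀ {u} → lookup E e ≡ (u , u) → ∀ a →
                  X G N a mt +ℤ X Gʳ N a mt ≡ onePlusQ* (X (deleteEdge G e) -ˢ X (deleteEdge G e)) N a mt
  loop-identity edge a = begin
    X G N a mt +ℤ X Gʳ N a mt
      ≡⟨ cong₂ _+ℤ_ (X-loop≡0 w E loop∈E N a mt) (X-loop≡0 w (updateAt E e swap) loop∈Eʳ N a mt) ⟩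
    0ℤ
      ≡⟨ ℤ.+-inverseʳ (ℤ.+ onePlusQᴺ Deleted a) ⟨
    ℤ.+ onePlusQᴺ Deleted a -ℤ ℤ.+ onePlusQᴺ Deleted a
      ≡⟨ onePlusQ*-counts (X (deleteEdge G e)) (X (deleteEdge G e)) N mt (λ _ → refl) (λ _ → refl) a ⟨
    onePlusQ* (X (deleteEdge G e) -ˢ X (deleteEdge G e)) N a mt ∎
    where
    open ≡-Reasoning
    loop∈E : _ ∈ E
    loop∈E = subst (_∈ E) edge (∈-lookup e)
    loop∈Eʳ : _ ∈ updateAt E e swap
    loop∈Eʳ = ∈-resp-↭ (↭-sym (updateAt-↭ E e swap)) (here (cong swap (sym edge)))
    Deleted : ℕ → ℕ
    Deleted b = count (counted? E′ b) (colorings (suc m) N)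

  module _ {u v} (edge : lookup E e ≡ (u , v)) (u≢v : u ≢ v) where

    open Contraction w mt E′ u≢v

    private
      Oriented : Fin (suc m) → Fin (suc m) → ℕ → ℕ
      Oriented t h b = count (λ κ → oriented? (κ t) (κ h) 𝟙[ κ t <? κ h ] (asc κ E′) b) (admissible E′)
      Monochromatic Deleted : ℕ → ℕ
      Monochromatic b = count (λ κ → monochromatic? (κ u) (κ v) (asc κ E′) b) (admissible E′)
      Deleted b = count (λ κ → asc κ E′ ℕ.≟ b) (admissible E′)

    count-split : ∀ a → Oriented u v a + Oriented v u a + onePlusQᴺ Monochromatic a ≡ onePlusQᴺ Deleted a
    count-split a =
      count-identity (λ κ → oriented? (κ u) (κ v) 𝟙[ κ u <? κ v ] (asc κ E′) a)
                     (λ κ → oriented? (κ v) (κ u) 𝟙[ κ v <? κ u ] (asc κ E′) a)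
                     (λ b κ → monochromatic? (κ u) (κ v) (asc κ E′) b) (λ b κ → asc κ E′ ℕ.≟ b)
                     (admissible E′) a (λ κ → edge-split (κ u) (κ v) _ _ (asc κ E′) a one-ascent)

    deletion-contraction : ∀ a →
      X G N a mt +ℤ X Gʳ N a mt ≡ onePlusQ* (X (deleteEdge G e) -ˢ X contracted) N a mt
    deletion-contraction a = begin
      X G N a mt +ℤ X Gʳ N a mt
        ≡⟨ cong₂ _+ℤ_ (cong ℤ.+_ (oriented-count E↭ a)) (cong ℤ.+_ (oriented-count Eʳ↭ a)) ⟩
      ℤ.+ Oriented u v a +ℤ ℤ.+ Oriented v u a
        ≡⟨ x+y+c≡d⇒x+y≡d-c (Oriented u v a) (Oriented v u a) _ _ (count-split a) ⟩
      ℤ.+ onePlusQᴺ Deleted a -ℤ ℤ.+ onePlusQᴺ Monochromatic a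
        ≡⟨ onePlusQ*-counts (X (deleteEdge G e)) (X contracted) N mt
                            (cong ℤ.+_ ∘ deleted-count E′) (cong ℤ.+_ ∘ contracted-count) a ⟨
      onePlusQ* (X (deleteEdge G e) -ˢ X contracted) N a mt ∎
      where
      open ≡-Reasoning
      E↭ : E ↭ (u , v) ∷ E′
      E↭ = subst (λ p → E ↭ p ∷ E′) edge (lookup-↭ E e)
      Eʳ↭ : updateAt E e swap ↭ (v , u) ∷ E′
      Eʳ↭ = subst (λ p → updateAt E e swap ↭ swap p ∷ E′) edge (updateAt-↭ E e swap)

lemma4 : (G : OWGraph) → (∀ v → NonZero (w G v)) → (e : Edge G) →
         (X G +ˢ X (reverseEdge G e))
           ≈ˢ onePlusQ* (X (deleteEdge G e) -ˢ X (contractEdge G e))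
lemma4 (mkGraph zero w E) _ e with lookup E e
... | () , _
lemma4 (mkGraph (suc m) w E) _ e N a mt with lookup E e in edge
... | u , v with u ≟ v
... | yes refl = loop-identity w mt E e edge a
... | no u≢v   = deletion-contraction w mt E e edge u≢v a
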